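{- In system STI, let $\Pi$ be a derivation of $\Gamma\vdash M:\sigma_1\wedge\cdots\wedge\sigma_m$ with $m>1$. Then $\Pi$ ends with a non-empty intersection tree.
   Context: Terms of the $\lambda$-calculus: $M ::= x \mid MM \mid \lambda x.M$, modulo renaming of bound variables. A term $M$ is an instance of $N$ if it is obtained from $N$ by renaming a subset of its free variables with a unique fresh name. Types of STI: linear types $A ::= a \mid \sigma \to A$ and intersection types $\sigma ::= A \mid \sigma_1 \wedge \cdots \wedge \sigma_n$ ($n>1$), with $n$-ary $\wedge$ commutative but neither idempotent nor associative. Contexts are finite sets of assumptions $x:\sigma$ with distinct variables; $\Gamma\#\Delta$ means disjoint domains, $\Gamma,\Delta$ their union; $\Gamma\wedge\Delta$ contains the assumptions of variables occurring in only one of them, and $x:\sigma\wedge\tau$ when $x:\sigma\in\Gamma$, $x:\tau\in\Delta$; $\bigwedge_{i=1}^n\Gamma_i$ is formed likewise. Rules of STI: (Ax) $x:A \vdash x:A$. (w) from $\Gamma\vdash M:\sigma$ and $x\notin\mathrm{dom}(\Gamma)$ infer $\Gamma, x:A\vdash M:\sigma$. ($\to$I) from $\Gamma, x:\sigma\vdash M:A$ infer $\Gamma\vdash\lambda x.M:\sigma\to A$. ($\to$E) from $\Gamma\vdash M:\sigma\to A$ and $\Delta\vdash N:\sigma$ with $\Gamma\#\Delta$ infer $\Gamma,\Delta\vdash MN:A$. ($\wedge_n$) for $n>1$, from $\Gamma_i\vdash M:\sigma_i$ ($1\le i\le n$) infer $\bigwedge_{i=1}^n\Gamma_i\vdash M:\sigma_1\wedge\cdots\wedge\sigma_n$.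 (m) from $\Gamma, x_1:\sigma_1,\dots,x_n:\sigma_n\vdash M:\tau$ infer $\Gamma, x:\sigma_1\wedge\cdots\wedge\sigma_n\vdash M[x/x_1,\dots,x/x_n]:\tau$. The rules (Ax), ($\to$I), ($\to$E) are called constructive. Intersection trees: let $(\delta)$ denote a possibly empty sequence of applications of rules (w) and (m). If $\Sigma$ is a derivation whose last rule is constructive, then $\Sigma$ followed by $(\delta)$ with conclusion $\Gamma\vdash M:\sigma$ is an empty intersection tree with one leaf $\Sigma$. If $\Sigma_i$ ($1\le i\le n$, $n>1$) are (possibly empty) intersection trees with conclusions $\Gamma_i\vdash M:\sigma_i$, then the derivation obtained by applying ($\wedge_n$) to them, yielding $\bigwedge_{i=1}^n\Gamma_i\vdash M:\sigma_1\wedge\cdots\wedge\sigma_n$, followed by a sequence $(\delta)$ ending with $\Gamma\vdash M':\sigma$ (so $M'$ is an instance of $M$) is an intersection tree (non-empty), whose leaves are the leaves of all the $\Sigma_i$. An intersection tree is required to be a maximal subproof of this shape; a derivation "ends with" an intersection tree if its final part is such a maximal subproof. -}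

module Defs where

open import Data.Nat using (ℕ; zero; suc; _≡ᵇ_)
open import Data.Bool using (Bool; true; false; if_then_else_; _∨_)
open import Data.Maybe using (Maybe; just; nothing)
open import Data.List using (List; []; _∷_; _++_; map; mapMaybe)
open import Data.Bool.ListAction using (any)
open import Data.List.Relation.Unary.Unique.Propositional using (Unique)
open import Data.List.Relation.Unary.All using (All)
open import Data.Product using (_×_; _,_; proj₁; proj₂; ∃-syntax)
open import Data.Sum using (_⊎_)
open import Relation.Binary.PropositionalEquality using (_≡_)

-- Terms of the λ-calculus, modulo α: locally nameless representation.
-- Free variables are named by ℕ, bound variables are de Bruijn indices,
-- so α-equivalent terms are syntactically equal.

data Term : Set where
  fvar : ℕ → Term
  bvar : ℕ → Term
  app  : Term → Term → Term
  lam  : Term → Term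

close : ℕ → ℕ → Term → Term
close k x (fvar y)  = if x ≡ᵇ y then bvar k else fvar y
close k x (bvar i)  = bvar i
close k x (app M N) = app (close k x M) (close k x N)
close k x (lam M)   = lam (close (suc k) x M)

ƛ : ℕ → Term → Term
ƛ x M = lam (close 0 x M)

rename : (ℕ → ℕ) → Term → Term
rename ρ (fvar y)  = fvar (ρ y)
rename ρ (bvar i)  = bvar i
rename ρ (app M N) = app (rename ρ M) (rename ρ N)
rename ρ (lam M)   = lam (rename ρ M)

_∈ᵇ_ : ℕ → List ℕ → Bool
y ∈ᵇ xs = any (λ z → z ≡ᵇ y) xs

merge-rename : ℕ → List ℕ → Term → Term
merge-rename x xs = rename (λ y → if y ∈ᵇ xs then x else y)

-- Types of STI.  Linear types A ::= a | σ → A,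
-- intersection types σ ::= A | σ₁ ∧ ⋯ ∧ σₙ  (n > 1, n-ary, not associative).
-- ⋀ σ₁ σ₂ [σ₃,…,σₙ] is σ₁ ∧ σ₂ ∧ σ₃ ∧ ⋯ ∧ σₙ.

mutual
  data LType : Set where
    atom : ℕ → LType
    _⇒_  : IType → LType → LType

  data IType : Set where
    lin : LType → IType
    ⋀   : IType → IType → List IType → IType

bigAnd : IType → List IType → IType
bigAnd σ []       = σ
bigAnd σ (τ ∷ ρs) = ⋀ σ τ ρs

-- Equality of types: ∧ is commutative (at any depth), but neither
-- idempotent nor associative.  _≅I_ is syntactic equality up to
-- permutation of the components of every n-ary intersection.
mutual
  data _≅L_ : LType → LType → Set where
    atom≅ : ∀ {a} → atom a ≅L atom a
    ⇒≅    : ∀ {σ τ A B} → σ ≅I τ → A ≅L B → (σ ⇒ A) ≅L (τ ⇒ B)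

  data _≅I_ : IType → IType → Set where
    lin≅ : ∀ {A B} → A ≅L B → lin A ≅I lin B
    ⋀≅   : ∀ {σ₁ σ₂ σs τ₁ τ₂ τs} →
           (σ₁ ∷ σ₂ ∷ σs) ≅P (τ₁ ∷ τ₂ ∷ τs) → ⋀ σ₁ σ₂ σs ≅I ⋀ τ₁ τ₂ τs

  data _≅P_ : List IType → List IType → Set where
    []≅ : [] ≅P []
    ∷≅  : ∀ {σ σs τ as bs} → σ ≅I τ → σs ≅P (as ++ bs) →
          (σ ∷ σs) ≅P (as ++ τ ∷ bs)

-- Contexts: finite sets of assumptions x : σ with distinct variables,
-- represented as partial maps ℕ → Maybe IType (all contexts built by the
-- rules have finite domain).

Ctx : Set
Ctx = ℕ → Maybe IType

single : ℕ → IType → Ctx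
single x σ y = if x ≡ᵇ y then just σ else nothing

-- Γ , x : σ   (used only when x ∉ dom Γ)
extend : Ctx → ℕ → IType → Ctx
extend Γ x σ y = if x ≡ᵇ y then just σ else Γ y

remove : Ctx → ℕ → Ctx
remove Γ x y = if x ≡ᵇ y then nothing else Γ y

removeAll : Ctx → List ℕ → Ctx
removeAll Γ xs y = if y ∈ᵇ xs then nothing else Γ y

Disjoint : Ctx → Ctx → Set
Disjoint Γ Δ = ∀ x → Γ x ≡ nothing ⊎ Δ x ≡ nothing

-- Γ , Δ  (used only when Γ # Δ)
union : Ctx → Ctx → Ctx
union Γ Δ y with Γ y
... | just σ  = just σ
... | nothing = Δ y

collect : List IType → Maybe IType
collect []           = nothing
collect (σ ∷ [])     = just σ
collect (σ ∷ τ ∷ ρs) = just (⋀ σ τ ρs)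

mergeAll : List Ctx → Ctx
mergeAll Γs y = collect (mapMaybe (λ Γ → Γ y) Γs)

infix 4 _⊢_∶_

mutual
  data _⊢_∶_ : Ctx → Term → IType → Set where
    ax  : ∀ x (A : LType) → single x (lin A) ⊢ fvar x ∶ lin A
    wk  : ∀ {Γ M σ} x (A : LType) → Γ x ≡ nothing → Γ ⊢ M ∶ σ →
          extend Γ x (lin A) ⊢ M ∶ σ
    -- (→I)  premise context Δ = Γ , x:σ
    ⇒I  : ∀ {Δ M σ} {A : LType} x → Δ x ≡ just σ → Δ ⊢ M ∶ lin A →
          remove Δ x ⊢ ƛ x M ∶ lin (σ ⇒ A)
    ⇒E  : ∀ {Γ Δ M N σ τ} {A : LType} →
          Γ ⊢ M ∶ lin (σ ⇒ A) → Δ ⊢ N ∶ τ → σ ≅I τ → Disjoint Γ Δ →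
          union Γ Δ ⊢ app M N ∶ lin A
    ∧I  : ∀ {M Γ₁ Γ₂ Γs σ₁ σ₂ σs} →
          Derivs M (Γ₁ ∷ Γ₂ ∷ Γs) (σ₁ ∷ σ₂ ∷ σs) →
          mergeAll (Γ₁ ∷ Γ₂ ∷ Γs) ⊢ M ∶ ⋀ σ₁ σ₂ σs
    -- (m), n ≥ 1: premise context Δ = Γ , x₁:σ₁ , … , xₙ:σₙ with
    -- Γ = removeAll Δ [x₁,…,xₙ]; x ∉ dom Γ.
    mg  : ∀ {Δ M τ} (x₁ : ℕ) (σ₁ : IType) (ps : List (ℕ × IType)) (x : ℕ) →
          Unique (x₁ ∷ map proj₁ ps) →
          All (λ p → Δ (proj₁ p) ≡ just (proj₂ p)) ((x₁ , σ₁) ∷ ps) →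
          removeAll Δ (x₁ ∷ map proj₁ ps) x ≡ nothing →
          Δ ⊢ M ∶ τ →
          extend (removeAll Δ (x₁ ∷ map proj₁ ps)) x (bigAnd σ₁ (map proj₂ ps))
            ⊢ merge-rename x (x₁ ∷ map proj₁ ps) M ∶ τ

  data Derivs (M : Term) : List Ctx → List IType → Set where
    []  : Derivs M [] []
    _∷_ : ∀ {Γ σ Γs σs} → Γ ⊢ M ∶ σ → Derivs M Γs σs → Derivs M (Γ ∷ Γs) (σ ∷ σs)

data Constructive : ∀ {Γ M σ} → Γ ⊢ M ∶ σ → Set where
  c-ax : ∀ {x A} → Constructive (ax x A)
  c-⇒I : ∀ {Δ M σ A x e} {Π : Δ ⊢ M ∶ lin A} → Constructive (⇒I {σ = σ} x e Π)
  c-⇒E : ∀ {Γ Δ M N σ τ A} {Π₁ : Γ ⊢ M ∶ lin (σ ⇒ A)} {Π₂ : Δ ⊢ N ∶ τ} {e d} →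
         Constructive (⇒E Π₁ Π₂ e d)

mutual
  data EmptyTree : ∀ {Γ M σ} → Γ ⊢ M ∶ σ → Set where
    leaf  : ∀ {Γ M σ} {Π : Γ ⊢ M ∶ σ} → Constructive Π → EmptyTree Π
    e-wk  : ∀ {Γ M σ x A e} {Π : Γ ⊢ M ∶ σ} → EmptyTree Π → EmptyTree (wk x A e Π)
    e-mg  : ∀ {Δ M τ x₁ σ₁ ps x u a f} {Π : Δ ⊢ M ∶ τ} → EmptyTree Π →
            EmptyTree (mg x₁ σ₁ ps x u a f Π)

  data NonEmptyTree : ∀ {Γ M σ} → Γ ⊢ M ∶ σ → Set where
    node  : ∀ {M Γ₁ Γ₂ Γs σ₁ σ₂ σs} {Πs : Derivs M (Γ₁ ∷ Γ₂ ∷ Γs) (σ₁ ∷ σ₂ ∷ σs)} →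
            AllTrees Πs → NonEmptyTree (∧I Πs)
    n-wk  : ∀ {Γ M σ x A e} {Π : Γ ⊢ M ∶ σ} → NonEmptyTree Π → NonEmptyTree (wk x A e Π)
    n-mg  : ∀ {Δ M τ x₁ σ₁ ps x u a f} {Π : Δ ⊢ M ∶ τ} → NonEmptyTree Π →
            NonEmptyTree (mg x₁ σ₁ ps x u a f Π)

  data AllTrees {M : Term} : ∀ {Γs σs} → Derivs M Γs σs → Set where
    []  : AllTrees []
    _∷_ : ∀ {Γ σ Γs σs} {Π : Γ ⊢ M ∶ σ} {Πs : Derivs M Γs σs} →
          (EmptyTree Π ⊎ NonEmptyTree Π) → AllTrees Πs → AllTrees (Π ∷ Πs)

-- Π ends with a non-empty intersection tree: the maximal final part of Π
-- consisting of (δ) steps below an application of (∧ₙ) to intersection trees.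
EndsWithNonEmptyTree : ∀ {Γ M σ} → Γ ⊢ M ∶ σ → Set
EndsWithNonEmptyTree Π = NonEmptyTree Π

module Submission where

open import Defs
open import Data.List using (List)
open import Data.Product using (_,_; ∃-syntax)
open import Data.Sum using (_⊎_; inj₁; inj₂)
open import Relation.Binary.PropositionalEquality using (_≡_; refl)

-- Every derivation ends with an intersection tree, and an empty one
-- carries a linear type: constructive rules conclude with linear types and
-- (w), (m) keep the type.  So a derivation of an intersection type can only
-- end with a non-empty tree.

IntersectionTree : ∀ {Γ M σ} → Γ ⊢ M ∶ σ → Set
IntersectionTree Π = EmptyTree Π ⊎ NonEmptyTree Π

mutual
  intersectionTree : ∀ {Γ M σ} (Π : Γ ⊢ M ∶ σ) → IntersectionTree Π
  intersectionTree (ax x A)       = inj₁ (leaf c-ax)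
  intersectionTree (⇒I x e Π)     = inj₁ (leaf c-⇒I)
  intersectionTree (⇒E Π₁ Π₂ e d) = inj₁ (leaf c-⇒E)
  intersectionTree (∧I Πs)         = inj₂ (node (intersectionTrees Πs))
  intersectionTree (wk x A e Π) with intersectionTree Π
  ... | inj₁ t = inj₁ (e-wk t)
  ... | inj₂ t = inj₂ (n-wk t)
  intersectionTree (mg x₁ σ₁ ps x u a f Π) with intersectionTree Π
  ... | inj₁ t = inj₁ (e-mg t)
  ... | inj₂ t = inj₂ (n-mg t)

  intersectionTrees : ∀ {M Γs σs} (Πs : Derivs M Γs σs) → AllTrees Πs
  intersectionTrees []       = []
  intersectionTrees (Π ∷ Πs) = intersectionTree Π ∷ intersectionTrees Πs

constructive⇒linear : ∀ {Γ M σ} {Π : Γ ⊢ M ∶ σ} → Constructive Π → ∃[ A ] σ ≡ lin A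
constructive⇒linear c-ax = _ , refl
constructive⇒linear c-⇒I = _ , refl
constructive⇒linear c-⇒E = _ , refl

emptyTree⇒linear : ∀ {Γ M σ} {Π : Γ ⊢ M ∶ σ} → EmptyTree Π → ∃[ A ] σ ≡ lin A
emptyTree⇒linear (leaf c) = constructive⇒linear c
emptyTree⇒linear (e-wk t) = emptyTree⇒linear t
emptyTree⇒linear (e-mg t) = emptyTree⇒linear t

mainTheorem3 : ∀ {Γ : Ctx} {M : Term} {σ₁ σ₂ : IType} {σs : List IType}
    (Π : Γ ⊢ M ∶ ⋀ σ₁ σ₂ σs) → EndsWithNonEmptyTree Π
mainTheorem3 Π with intersectionTree Π
... | inj₂ t = t
... | inj₁ t with emptyTree⇒linear t
...   | _ , ()
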